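{- For all ${\sf FIL}$-formulas $A,B$ and every interpretation variable $k$: $$\Box(A\rhd^{k}B),\ \big((B\wedge\Diamond A\rhd^{k}B\wedge\Box^{k}\neg B)\to(B\wedge\Diamond A\rhd B\wedge\Box^{k}\neg B)\big)\ \vdash_{\sf FIL}\ B\wedge\Diamond A\rhd B\wedge\Box\neg A.$$
   Context: The logic ${\sf FIL}$: the language has propositional variables, interpretation variables $k_0,k_1,\dots$, one interpretation constant ${\sf id}$, $\top,\bot$, Boolean connectives and modalities $\Box^{\mathfrak a}A$, $A\rhd^{\mathfrak a}B$ where $\mathfrak a$ is a finite sequence of interpretation terms without repetition; unlabelled $\Box,\rhd$ stand for label ${\sf id}$ / the empty sequence; $\Diamond^{\mathfrak a}:=\neg\Box^{\mathfrak a}\neg$; $\mathfrak a,k$ is $\mathfrak a$ extended by $k$. Sequents $\Gamma\vdash C$ with $\Gamma$ a multiset, with $\Gamma,\Delta\vdash C$ iff $\Delta\vdash\bigwedge\Gamma\to C$. Axioms/rules (for all labels $\mathfrak a,\mathfrak b$, terms $k$): all tautologies; modus ponens; $\Box^{\mathfrak a}(A\to B)\to(\Box^{\mathfrak a}A\to\Box^{\mathfrak a}B)$; $\Box^{\mathfrak b}A\to\Box^{\mathfrak a}\Box^{\mathfrak b}A$; $\Box^{\mathfrak a}(\Box^{\mathfrak a}A\to A)\to\Box^{\mathfrak a}A$; $\Box^{\mathfrak a}(A\to B)\to A\rhd^{\mathfrak a}B$; $(A\rhd B)\wedge(B\rhd^{\mathfrak a}C)\to A\rhd^{\mathfrak a}C$;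 $(A\rhd^{\mathfrak a}B)\wedge\Box^{\mathfrak a}(B\to C)\to A\rhd^{\mathfrak a}C$; $(A\rhd^{\mathfrak a}C)\wedge(B\rhd^{\mathfrak a}C)\to A\vee B\rhd^{\mathfrak a}C$; $A\rhd^{\mathfrak a}B\to(\Diamond A\to\Diamond^{\mathfrak a}B)$; $A\rhd^{\mathfrak a}\Diamond^{\mathfrak b}B\to A\rhd^{\mathfrak b}B$; $\Box^{\mathfrak a,k}A\to\Box^{\mathfrak a}A$; $A\rhd^{\mathfrak a}B\to A\rhd^{\mathfrak a,k}B$; necessitation $\vdash A\Rightarrow\vdash\Box^{\mathfrak a}A$; rule $\mathsf P^{\mathfrak a,\mathfrak b,k}$: from $\Gamma,\Delta,\Box^{\mathfrak b}(A\rhd^{\mathfrak a,k}B)\vdash C$ infer $\Gamma,A\rhd^{\mathfrak a}B\vdash C$, provided $k$ is an interpretation variable not occurring in $\mathfrak a,\Gamma,A,B,C$ and $\Delta$ consists of formulas of the forms $E\rhd^{\mathfrak a,k}F\to E\rhd^{\mathfrak a}F$ and $\Box^{\mathfrak a}E\to\Box^{\mathfrak a,k}E$. Binding: $\neg,\Box,\Diamond$ strongest, Boolean connectives other than $\to$ bind stronger than $\rhd$, $\rhd$ stronger than $\to$. -}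

module Defs where

open import Data.Nat using (ℕ)
open import Data.Bool using (Bool; true; false; not; _∧_; _∨_)
open import Data.List using (List; []; _∷_; _++_; [_]; _∷ʳ_)
open import Data.List.Membership.Propositional using (_∈_; _∉_)
open import Data.List.Relation.Unary.All using (All)
open import Data.List.Relation.Unary.Unique.Propositional using (Unique)
open import Data.Product using (Σ; ∃; ∃₂; _×_; _,_; proj₁)
open import Data.Sum using (_⊎_)
open import Relation.Binary.PropositionalEquality using (_≡_)
open import Relation.Nullary using (¬_)

data ITerm : Set where
  ivar : ℕ → ITerm
  iid  : ITerm

record Label : Set where
  constructor mkLabel
  field
    terms  : List ITerm
    unique : Unique terms
open Label public

ε : Label
ε = mkLabel [] Data.List.Relation.Unary.Unique.Propositional.[]

ext : (a : Label) (k : ITerm) → k ∉ terms a → Label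
ext (mkLabel ts u) k k∉ = mkLabel (ts ∷ʳ k) (snoc-unique ts u k∉)
  where
  open import Data.List.Relation.Unary.AllPairs using (AllPairs; []; _∷_)
  open import Data.List.Relation.Unary.All using ([]; _∷_)
  open import Data.List.Relation.Unary.Any using (here; there)
  snoc-unique : (xs : List ITerm) → Unique xs → ∀ {y} → y ∉ xs → Unique (xs ∷ʳ y)
  snoc-unique [] _ _ = [] ∷ []
  snoc-unique (x ∷ xs) (px ∷ u) {y} y∉ =
    allsnoc px (λ x≡y → y∉ (here (Relation.Binary.PropositionalEquality.sym x≡y)))
      ∷ snoc-unique xs u (λ m → y∉ (there m))
    where
    allsnoc : ∀ {zs} → All (λ z → ¬ x ≡ z) zs → ¬ x ≡ y → All (λ z → ¬ x ≡ z) (zs ∷ʳ y)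
    allsnoc [] n = n ∷ []
    allsnoc (p ∷ ps) n = p ∷ allsnoc ps n

infixr 4 _⇒_
infixr 5 _∨'_
infixr 6 _∧'_
data Fm : Set where
  pv    : ℕ → Fm
  ⊤'    : Fm
  ⊥'    : Fm
  ¬'_   : Fm → Fm
  _∧'_  : Fm → Fm → Fm
  _∨'_  : Fm → Fm → Fm
  _⇒_   : Fm → Fm → Fm
  □[_]_ : Label → Fm → Fm
  _▷[_]_ : Fm → Label → Fm → Fm

□ : Fm → Fm
□ A = □[ ε ] A

_▷_ : Fm → Fm → Fm
A ▷ B = A ▷[ ε ] B

◇[_]_ : Label → Fm → Fm
◇[ a ] A = ¬' (□[ a ] (¬' A))

◇ : Fm → Fm
◇ A = ◇[ ε ] A

OccL : ℕ → Label → Set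
OccL n a = ivar n ∈ terms a

data Occ (n : ℕ) : Fm → Set where
  o¬   : ∀ {A} → Occ n A → Occ n (¬' A)
  o∧l  : ∀ {A B} → Occ n A → Occ n (A ∧' B)
  o∧r  : ∀ {A B} → Occ n B → Occ n (A ∧' B)
  o∨l  : ∀ {A B} → Occ n A → Occ n (A ∨' B)
  o∨r  : ∀ {A B} → Occ n B → Occ n (A ∨' B)
  o⇒l  : ∀ {A B} → Occ n A → Occ n (A ⇒ B)
  o⇒r  : ∀ {A B} → Occ n B → Occ n (A ⇒ B)
  o□l  : ∀ {a A} → OccL n a → Occ n (□[ a ] A)
  o□f  : ∀ {a A} → Occ n A → Occ n (□[ a ] A)
  o▷l  : ∀ {a A B} → OccL n a → Occ n (A ▷[ a ] B)
  o▷a  : ∀ {a A B} → Occ n A → Occ n (A ▷[ a ] B)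
  o▷b  : ∀ {a A B} → Occ n B → Occ n (A ▷[ a ] B)

eval : (Fm → Bool) → Fm → Bool
eval v (pv p) = v (pv p)
eval v ⊤' = true
eval v ⊥' = false
eval v (¬' A) = not (eval v A)
eval v (A ∧' B) = eval v A ∧ eval v B
eval v (A ∨' B) = eval v A ∨ eval v B
eval v (A ⇒ B) = not (eval v A) ∨ eval v B
eval v (□[ a ] A) = v (□[ a ] A)
eval v (A ▷[ a ] B) = v (A ▷[ a ] B)

Tautology : Fm → Set
Tautology A = ∀ (v : Fm → Bool) → eval v A ≡ true

⋀ : List Fm → Fm
⋀ [] = ⊤'
⋀ (A ∷ Γ) = A ∧' ⋀ Γ

-- Shapes allowed in Δ for the rule P^{𝔞,𝔟,k}, where 𝔞k is the label 𝔞,k.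
DeltaShape : Label → Label → Fm → Set
DeltaShape a ak D =
  (∃₂ λ E F → D ≡ ((E ▷[ ak ] F) ⇒ (E ▷[ a ] F)))
  ⊎ (∃ λ E → D ≡ ((□[ a ] E) ⇒ (□[ ak ] E)))

data ⊢_ : Fm → Set
_⊢ₛ_ : List Fm → Fm → Set
Γ ⊢ₛ C = ⊢ (⋀ Γ ⇒ C)

data ⊢_ where
  taut : ∀ {A} → Tautology A → ⊢ A
  mp   : ∀ {A B} → ⊢ (A ⇒ B) → ⊢ A → ⊢ B
  axK  : ∀ {a A B} → ⊢ (□[ a ] (A ⇒ B) ⇒ (□[ a ] A ⇒ □[ a ] B))
  ax4  : ∀ {a b A} → ⊢ (□[ b ] A ⇒ □[ a ] (□[ b ] A))
  axL  : ∀ {a A} → ⊢ (□[ a ] (□[ a ] A ⇒ A) ⇒ □[ a ] A)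
  axJ1 : ∀ {a A B} → ⊢ (□[ a ] (A ⇒ B) ⇒ (A ▷[ a ] B))
  axJ2 : ∀ {a A B C} → ⊢ (((A ▷ B) ∧' (B ▷[ a ] C)) ⇒ (A ▷[ a ] C))
  axJ2' : ∀ {a A B C} → ⊢ (((A ▷[ a ] B) ∧' □[ a ] (B ⇒ C)) ⇒ (A ▷[ a ] C))
  axJ3 : ∀ {a A B C} → ⊢ (((A ▷[ a ] C) ∧' (B ▷[ a ] C)) ⇒ ((A ∨' B) ▷[ a ] C))
  axJ4 : ∀ {a A B} → ⊢ ((A ▷[ a ] B) ⇒ (◇ A ⇒ ◇[ a ] B))
  axJ5 : ∀ {a b A B} → ⊢ ((A ▷[ a ] (◇[ b ] B)) ⇒ (A ▷[ b ] B))
  axMon□ : ∀ {a k A} (k∉ : k ∉ terms a) → ⊢ (□[ ext a k k∉ ] A ⇒ □[ a ] A)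
  axMon▷ : ∀ {a k A B} (k∉ : k ∉ terms a) → ⊢ ((A ▷[ a ] B) ⇒ (A ▷[ ext a k k∉ ] B))
  nec  : ∀ {a A} → ⊢ A → ⊢ (□[ a ] A)
  ruleP : ∀ {a b : Label} {n : ℕ} {Γ Δ : List Fm} {A B C : Fm}
          (k∉ : ivar n ∉ terms a) →
          All (λ D → ¬ Occ n D) Γ → ¬ Occ n A → ¬ Occ n B → ¬ Occ n C →
          All (DeltaShape a (ext a (ivar n) k∉)) Δ →
          (Γ ++ Δ ++ [ □[ b ] (A ▷[ ext a (ivar n) k∉ ] B) ]) ⊢ₛ C →
          (Γ ++ [ A ▷[ a ] B ]) ⊢ₛ C

{-# OPTIONS --safe #-}
-- Under □, axiom J4 turns A ▷ᵏ B into ◇A → ◇ᵏB. By Löb's axiom ◇ᵏB implies ◇ᵏ(B ∧ □ᵏ¬B), so J1 and J5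
-- give B ∧ ◇A ▷ᵏ B ∧ □ᵏ¬B, which the second hypothesis makes unlabelled. Contraposing ◇A → ◇ᵏB under □
-- gives □(B ∧ □ᵏ¬B → B ∧ □¬A), and J2' concludes.
module Submission where

open import Defs
open import Data.Bool using (Bool; true; false; not; _∧_; _∨_; T)
open import Data.Bool.Properties using (T-≡; T-∧)
open import Data.Fin using (Fin)
open import Data.List using ([]; _∷_)
open import Data.Nat using (ℕ; zero; suc)
open import Data.Product using (proj₁; proj₂)
open import Data.Vec using (Vec; []; _∷_; lookup; map; allFin)
open import Data.Vec.N-ary using (N-ary; _$ⁿ_)
open import Data.Vec.Properties using (lookup-map)
open import Function using (_∘_)
open import Function.Bundles using (Equivalence)
open import Relation.Binary.PropositionalEquality using (_≡_; refl; sym; cong; cong₂; trans)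

open Equivalence using (to)

data Schema (n : ℕ) : Set where
  var            : Fin n → Schema n
  :⊤ :⊥          : Schema n
  :¬_            : Schema n → Schema n
  _:∧_ _:∨_ _:⇒_ : Schema n → Schema n → Schema n

infixr 4 _:⇒_
infixr 5 _:∨_
infixr 6 _:∧_

_⟪_⟫ : ∀ {n} → Schema n → Vec Fm n → Fm
var i    ⟪ σ ⟫ = lookup σ i
:⊤       ⟪ σ ⟫ = ⊤'
:⊥       ⟪ σ ⟫ = ⊥'
(:¬ φ)   ⟪ σ ⟫ = ¬' (φ ⟪ σ ⟫)
(φ :∧ ψ) ⟪ σ ⟫ = φ ⟪ σ ⟫ ∧' ψ ⟪ σ ⟫
(φ :∨ ψ) ⟪ σ ⟫ = φ ⟪ σ ⟫ ∨' ψ ⟪ σ ⟫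
(φ :⇒ ψ) ⟪ σ ⟫ = φ ⟪ σ ⟫ ⇒ ψ ⟪ σ ⟫

⟦_⟧ : ∀ {n} → Schema n → Vec Bool n → Bool
⟦ var i  ⟧ ρ = lookup ρ i
⟦ :⊤     ⟧ ρ = true
⟦ :⊥     ⟧ ρ = false
⟦ :¬ φ   ⟧ ρ = not (⟦ φ ⟧ ρ)
⟦ φ :∧ ψ ⟧ ρ = ⟦ φ ⟧ ρ ∧ ⟦ ψ ⟧ ρ
⟦ φ :∨ ψ ⟧ ρ = ⟦ φ ⟧ ρ ∨ ⟦ ψ ⟧ ρ
⟦ φ :⇒ ψ ⟧ ρ = not (⟦ φ ⟧ ρ) ∨ ⟦ ψ ⟧ ρ

eval-⟪⟫ : ∀ {n} v (φ : Schema n) σ → eval v (φ ⟪ σ ⟫) ≡ ⟦ φ ⟧ (map (eval v) σ)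
eval-⟪⟫ v (var i)  σ = sym (lookup-map i (eval v) σ)
eval-⟪⟫ v :⊤       σ = refl
eval-⟪⟫ v :⊥       σ = refl
eval-⟪⟫ v (:¬ φ)   σ = cong not (eval-⟪⟫ v φ σ)
eval-⟪⟫ v (φ :∧ ψ) σ = cong₂ _∧_ (eval-⟪⟫ v φ σ) (eval-⟪⟫ v ψ σ)
eval-⟪⟫ v (φ :∨ ψ) σ = cong₂ _∨_ (eval-⟪⟫ v φ σ) (eval-⟪⟫ v ψ σ)
eval-⟪⟫ v (φ :⇒ ψ) σ = cong₂ (_∨_ ∘ not) (eval-⟪⟫ v φ σ) (eval-⟪⟫ v ψ σ)

holdsEverywhere : ∀ n → (Vec Bool n → Bool) → Bool
holdsEverywhere zero    f = f []
holdsEverywhere (suc n) f = holdsEverywhere n (f ∘ (true ∷_)) ∧ holdsEverywhere n (f ∘ (false ∷_))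

holdsEverywhere-sound : ∀ n f → T (holdsEverywhere n f) → ∀ ρ → f ρ ≡ true
holdsEverywhere-sound zero    f ok []          = to T-≡ ok
holdsEverywhere-sound (suc n) f ok (true ∷ ρ)  = holdsEverywhere-sound n _ (proj₁ (to T-∧ ok)) ρ
holdsEverywhere-sound (suc n) f ok (false ∷ ρ) = holdsEverywhere-sound n _ (proj₂ (to T-∧ ok)) ρ

-- For a valid schema the implicit argument normalises to T true, the unit type, so it is found automatically.
tautology : ∀ n (φ : N-ary n (Schema n) (Schema n)) → let φ̂ = φ $ⁿ map var (allFin n) in
            (σ : Vec Fm n) → {T (holdsEverywhere n ⟦ φ̂ ⟧)} → ⊢ (φ̂ ⟪ σ ⟫)
tautology n φ σ {ok} = taut λ v →
  trans (eval-⟪⟫ v φ̂ σ) (holdsEverywhere-sound n ⟦ φ̂ ⟧ ok (map (eval v) σ))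
  where φ̂ = φ $ⁿ map var (allFin n)

⇒-trans : ∀ {P Q R} → ⊢ (P ⇒ Q) → ⊢ (Q ⇒ R) → ⊢ (P ⇒ R)
⇒-trans {P} {Q} {R} p⇒q q⇒r =
  mp (mp (tautology 3 (λ p q r → (p :⇒ q) :⇒ (q :⇒ r) :⇒ p :⇒ r) (P ∷ Q ∷ R ∷ [])) p⇒q) q⇒r

contraposition : ∀ {P Q} → ⊢ (P ⇒ Q) → ⊢ (¬' Q ⇒ ¬' P)
contraposition {P} {Q} = mp (tautology 2 (λ p q → (p :⇒ q) :⇒ :¬ q :⇒ :¬ p) (P ∷ Q ∷ []))

□-mono : ∀ {a P Q} → ⊢ (P ⇒ Q) → ⊢ (□[ a ] P ⇒ □[ a ] Q)
□-mono p⇒q = mp axK (nec p⇒q)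

◇-löb : ∀ {a} B → ⊢ (◇[ a ] B ⇒ ◇[ a ] (B ∧' □[ a ] (¬' B)))
◇-löb {a} B = contraposition (⇒-trans (□-mono ¬[B∧□¬B]⇒□¬B⇒¬B) axL)
  where
  ¬[B∧□¬B]⇒□¬B⇒¬B : ⊢ (¬' (B ∧' □[ a ] (¬' B)) ⇒ (□[ a ] (¬' B) ⇒ ¬' B))
  ¬[B∧□¬B]⇒□¬B⇒¬B = tautology 2 (λ b □¬b → :¬ (b :∧ □¬b) :⇒ □¬b :⇒ :¬ b) (B ∷ □[ a ] (¬' B) ∷ [])

□◇-from-▷ : ∀ {a b A B} → ⊢ (□[ b ] (A ▷[ a ] B) ⇒ □[ b ] (◇ A ⇒ ◇[ a ] B))
□◇-from-▷ = □-mono axJ4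

▷-from-□◇ : ∀ {a A B} → ⊢ (□ (A ⇒ ◇[ a ] B) ⇒ (A ▷[ a ] B))
▷-from-□◇ = ⇒-trans axJ1 axJ5

▷-löb : ∀ {a} A B →
  ⊢ (□ (◇ A ⇒ ◇[ a ] B) ⇒ ((B ∧' ◇ A) ▷[ a ] (B ∧' □[ a ] (¬' B))))
▷-löb {a} A B = ⇒-trans (□-mono (mp sharpen (◇-löb B))) ▷-from-□◇
  where
  C : Fm
  C = B ∧' □[ a ] (¬' B)
  sharpen : ⊢ ((◇[ a ] B ⇒ ◇[ a ] C) ⇒ (◇ A ⇒ ◇[ a ] B) ⇒ (B ∧' ◇ A ⇒ ◇[ a ] C))
  sharpen = tautology 4 (λ ◇a ◇b ◇c b → (◇b :⇒ ◇c) :⇒ (◇a :⇒ ◇b) :⇒ b :∧ ◇a :⇒ ◇c)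
              (◇ A ∷ ◇[ a ] B ∷ ◇[ a ] C ∷ B ∷ [])

□-□¬-from-□◇ : ∀ {a} A B →
  ⊢ (□ (◇ A ⇒ ◇[ a ] B) ⇒ □ (B ∧' □[ a ] (¬' B) ⇒ B ∧' □ (¬' A)))
□-□¬-from-□◇ {a} A B =
  □-mono (tautology 3 (λ □¬a □¬b b → (:¬ □¬a :⇒ :¬ □¬b) :⇒ b :∧ □¬b :⇒ b :∧ □¬a)
                      (□ (¬' A) ∷ □[ a ] (¬' B) ∷ B ∷ []))

⊢ₛ-chain : ∀ {H Y W Z G} → ⊢ (H ⇒ Y) → ⊢ (H ⇒ Z) → ⊢ (W ∧' Z ⇒ G) → (H ∷ (Y ⇒ W) ∷ []) ⊢ₛ G
⊢ₛ-chain {H} {Y} {W} {Z} {G} h⇒y h⇒z w∧z⇒g =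
  mp (mp (mp (tautology 5 (λ h y w z g → (h :⇒ y) :⇒ (h :⇒ z) :⇒ (w :∧ z :⇒ g) :⇒ h :∧ (y :⇒ w) :∧ :⊤ :⇒ g)
                          (H ∷ Y ∷ W ∷ Z ∷ G ∷ []))
             h⇒y) h⇒z) w∧z⇒g

▷-□¬ : ∀ a A B → let C = B ∧' □[ a ] (¬' B) in
  (□ (A ▷[ a ] B) ∷ (((B ∧' ◇ A) ▷[ a ] C) ⇒ ((B ∧' ◇ A) ▷ C)) ∷ []) ⊢ₛ ((B ∧' ◇ A) ▷ (B ∧' □ (¬' A)))
▷-□¬ a A B = ⊢ₛ-chain (⇒-trans □◇-from-▷ (▷-löb A B)) (⇒-trans □◇-from-▷ (□-□¬-from-□◇ A B)) axJ2'

mainTheorem20 : (A B : Fm) (n : ℕ) →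
    let k = ext ε (ivar n) (λ ()) in
    (□ (A ▷[ k ] B) ∷ (((B ∧' ◇ A) ▷[ k ] (B ∧' □[ k ] (¬' B))) ⇒ ((B ∧' ◇ A) ▷ (B ∧' □[ k ] (¬' B)))) ∷ [])
      ⊢ₛ ((B ∧' ◇ A) ▷ (B ∧' □ (¬' A)))
mainTheorem20 A B n = ▷-□¬ (ext ε (ivar n) (λ ())) A B
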